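{- For each pointed $\Pi$-model $(M,w)$ and $\Pi$-program $\Lambda$ of $\mathrm{GGMSC}$, $M,w\models\Lambda$ if and only if Eloise has a winning strategy in the global semantic game $\mathcal{G}^*(M,w,\Lambda)$.
   Context: $\mathrm{GGMSC}$ programs: over $\Pi$ and schema variables $\mathcal{T}$, each $X\in\mathcal{T}$ has a base rule $X(0) :- \varphi_X$ ($\varphi_X$ a formula of graded modal logic with counting global modality) and induction rule $X :- \psi_X$ ($\psi_X$ may contain variables from $\mathcal{T}$ as atoms), with a set of accepting predicates; $X^0:=\varphi_X$, $X^{n+1}$ is $\psi_X$ with each $Y$ replaced by $Y^n$; $M,w\models\Lambda$ iff $M,w\models X^n$ for some $n$ and accepting $X$. A labeled tuple over $M=(W,R,V)$ is a function $f\colon W\to\wp(\mathcal{T})$; $(M_f,v)\models\psi$ for a schema $\psi$ is defined as usual with $X$ true at $v$ iff $X\in f(v)$ (equivalently Eloise wins the standard evaluation game for $\psi$ on $M_f$ from $v$). The game $\mathcal{G}^*(M,w,\Lambda)$: positions are labeled tuples. Eloise first picks an initial position $f$ with $X\in f(w)$ for some accepting $X$ (if none exists, Abelard wins). In a position $f$, Eloise declares whether $f$ is final. If final, Abelard picks $v\in W$ and a head predicate $X$, and Eloise wins iff ($X\in f(v)$ iff $M,v\models\varphi_X$). Otherwise Eloise gives a labeled tuple $g$; Abelard either does not challenge (play continues from $g$) or challenges, picking $v\in W$ and head predicate $X$, and Eloise wins iff ($X\in f(v)$ iff $M_g,v\models\psi_X$). -}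

module Defs where

open import Data.Nat using (ℕ; zero; suc)
open import Data.Fin using (Fin)
open import Data.Bool using (Bool; true)
open import Data.Empty using (⊥)
open import Data.Unit using (⊤)
open import Data.Product using (Σ; _×_; ∃)
open import Relation.Nullary using (¬_)
open import Relation.Binary.PropositionalEquality using (_≡_)
open import Function.Base using (_∘_)
open import Function.Bundles using (_⇔_)
open import Function.Definitions using (Injective)

record Model (Π : Set) : Set₁ where
  field
    W : Set
    R : W → W → Set
    V : W → Π → Set
open Model public

-- Formulas of graded modal logic with counting global modality,
-- with atoms from A for schema variables (A = ⊥ gives plain formulas)

data Form (Π : Set) (A : Set) : Set where
  prop   : Π → Form Π A
  var    : A → Form Π A
  tt     : Form Π A
  neg    : Form Π A → Form Π A
  and    : Form Π A → Form Π A → Form Π A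
  dia≥   : ℕ → Form Π A → Form Π A
  glob≥  : ℕ → Form Π A → Form Π A

AtLeast : {W : Set} → ℕ → (W → Set) → Set
AtLeast {W} k P = Σ (Fin k → W) λ h → Injective _≡_ _≡_ h × (∀ i → P (h i))

Sat : {Π A : Set} (M : Model Π) → (W M → A → Set) → Form Π A → W M → Set
Sat M g (prop p)    w = V M w p
Sat M g (var X)     w = g w X
Sat M g tt          w = ⊤
Sat M g (neg φ)     w = ¬ Sat M g φ w
Sat M g (and φ ψ)   w = Sat M g φ w × Sat M g ψ w
Sat M g (dia≥ k φ)  w = AtLeast k (λ v → R M w v × Sat M g φ v)
Sat M g (glob≥ k φ) w = AtLeast k (λ v → Sat M g φ v)

noVars : {W : Set} → W → ⊥ → Set
noVars _ ()

_,_⊨_ : {Π : Set} (M : Model Π) → W M → Form Π ⊥ → Set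
M , w ⊨ φ = Sat M noVars φ w

subst : {Π A B : Set} → (A → Form Π B) → Form Π A → Form Π B
subst σ (prop p)    = prop p
subst σ (var X)     = σ X
subst σ tt          = tt
subst σ (neg φ)     = neg (subst σ φ)
subst σ (and φ ψ)   = and (subst σ φ) (subst σ ψ)
subst σ (dia≥ k φ)  = dia≥ k (subst σ φ)
subst σ (glob≥ k φ) = glob≥ k (subst σ φ)

record Program (Π : Set) (m : ℕ) : Set where
  field
    base      : Fin m → Form Π ⊥
    induct    : Fin m → Form Π (Fin m)
    accepting : Fin m → Bool
open Program public

iter : {Π : Set} {m : ℕ} → Program Π m → ℕ → Fin m → Form Π ⊥
iter Λ zero    X = base Λ X
iter Λ (suc n) X = subst (iter Λ n) (induct Λ X)

Accepting : {Π : Set} {m : ℕ} → Program Π m → Fin m → Set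
Accepting Λ X = accepting Λ X ≡ true

_,_⊨ᴾ_ : {Π : Set} {m : ℕ} (M : Model Π) → W M → Program Π m → Set
M , w ⊨ᴾ Λ = Σ ℕ λ n → Σ _ λ X → Accepting Λ X × (M , w ⊨ iter Λ n X)

-- labeled tuples: f : W → ℘(T), a subset given as a predicate
LabeledTuple : {Π : Set} → Model Π → ℕ → Set₁
LabeledTuple M m = W M → Fin m → Set

-- Defined inductively: every play in which Eloise never declares a
-- position final is infinite and lost by her.
--  * final f: Abelard picks any v, X; Eloise wins iff X∈f(v) ⇔ M,v ⊨ φ_X
--  * Eloise gives g: Abelard may challenge with any v, X (Eloise wins iff
--    X∈f(v) ⇔ M_g,v ⊨ ψ_X) or continue from g.
data EloiseWinsFrom {Π : Set} {m : ℕ} (M : Model Π) (Λ : Program Π m)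
                    (f : LabeledTuple M m) : Set₁ where
  declareFinal : (∀ v X → f v X ⇔ (M , v ⊨ base Λ X))
               → EloiseWinsFrom M Λ f
  proceed      : (g : LabeledTuple M m)
               → (∀ v X → f v X ⇔ Sat M g (induct Λ X) v)
               → EloiseWinsFrom M Λ g
               → EloiseWinsFrom M Λ f

EloiseWins : {Π : Set} {m : ℕ} (M : Model Π) → W M → Program Π m → Set₁
EloiseWins {m = m} M w Λ =
  Σ (LabeledTuple M m) λ f →
    (Σ (Fin m) λ X → Accepting Λ X × f w X) × EloiseWinsFrom M Λ f

module Submission where

open import Defs
open import Data.Nat using (ℕ; zero; suc)
open import Data.Product using (Σ; _,_; map₂)
open import Data.Product.Function.NonDependent.Propositional using (_×-⇔_)
open import Function.Bundles using (_⇔_; mk⇔; Equivalence)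
open import Function.Related.TypeIsomorphisms using (¬-cong-⇔)
open import Function.Construct.Composition using (_⇔-∘_)
open import Function.Construct.Identity using (⇔-id)
open import Function.Construct.Symmetry using (⇔-sym)

-- Eloise wins from f exactly when f agrees pointwise with the labeling v ↦ {X | M,v ⊨ X^n}
-- for some n, namely the number of moves before she declares a position final: the final
-- position is checked against the base rules, and each unchallenged move f ↦ g certifies
-- that f is ψ evaluated on g, which by the substitution lemma is one more unfolding.

AtLeast-cong : {W : Set} {P Q : W → Set} (k : ℕ) → (∀ v → P v ⇔ Q v) → AtLeast k P ⇔ AtLeast k Q
AtLeast-cong k P⇔Q = mk⇔ (map₂ (map₂ λ p i → Equivalence.to (P⇔Q _) (p i)))
                         (map₂ (map₂ λ q i → Equivalence.from (P⇔Q _) (q i)))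

Sat-subst : {Π A B : Set} (M : Model Π) (g : W M → B → Set) (g′ : W M → A → Set)
            (σ : A → Form Π B) → (∀ u Y → g′ u Y ⇔ Sat M g (σ Y) u)
          → ∀ φ v → Sat M g (subst σ φ) v ⇔ Sat M g′ φ v
Sat-subst M g g′ σ g′⇔σ (prop p)    v = ⇔-id _
Sat-subst M g g′ σ g′⇔σ (var Y)     v = ⇔-sym (g′⇔σ v Y)
Sat-subst M g g′ σ g′⇔σ tt          v = ⇔-id _
Sat-subst M g g′ σ g′⇔σ (neg φ)     v = ¬-cong-⇔ (Sat-subst M g g′ σ g′⇔σ φ v)
Sat-subst M g g′ σ g′⇔σ (and φ ψ)   v =
  Sat-subst M g g′ σ g′⇔σ φ v ×-⇔ Sat-subst M g g′ σ g′⇔σ ψ v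
Sat-subst M g g′ σ g′⇔σ (dia≥ k φ)  v =
  AtLeast-cong k λ u → ⇔-id (R M v u) ×-⇔ Sat-subst M g g′ σ g′⇔σ φ u
Sat-subst M g g′ σ g′⇔σ (glob≥ k φ) v = AtLeast-cong k (Sat-subst M g g′ σ g′⇔σ φ)

iterLabeling : {Π : Set} {m : ℕ} (M : Model Π) (Λ : Program Π m) → ℕ → LabeledTuple M m
iterLabeling M Λ n v X = M , v ⊨ iter Λ n X

iter-suc⇔induct : {Π : Set} {m : ℕ} (M : Model Π) (Λ : Program Π m) (n : ℕ) (g : LabeledTuple M m)
                → (∀ v X → g v X ⇔ iterLabeling M Λ n v X)
                → ∀ v X → iterLabeling M Λ (suc n) v X ⇔ Sat M g (induct Λ X) v
iter-suc⇔induct M Λ n g g⇔iter v X = Sat-subst M noVars g (iter Λ n) g⇔iter (induct Λ X) v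

EloiseWinsFrom-iterLabeling : {Π : Set} {m : ℕ} (M : Model Π) (Λ : Program Π m) (n : ℕ)
                            → EloiseWinsFrom M Λ (iterLabeling M Λ n)
EloiseWinsFrom-iterLabeling M Λ zero    = declareFinal λ _ _ → ⇔-id _
EloiseWinsFrom-iterLabeling M Λ (suc n) =
  proceed (iterLabeling M Λ n) (iter-suc⇔induct M Λ n _ λ _ _ → ⇔-id _)
          (EloiseWinsFrom-iterLabeling M Λ n)

EloiseWinsFrom⇒≈iterLabeling : {Π : Set} {m : ℕ} (M : Model Π) (Λ : Program Π m) (f : LabeledTuple M m)
                             → EloiseWinsFrom M Λ f → Σ ℕ λ n → ∀ v X → f v X ⇔ iterLabeling M Λ n v X
EloiseWinsFrom⇒≈iterLabeling M Λ f (declareFinal f⇔base) = zero , f⇔base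
EloiseWinsFrom⇒≈iterLabeling M Λ f (proceed g f⇔induct wins-g)
  with n , g⇔iter ← EloiseWinsFrom⇒≈iterLabeling M Λ g wins-g =
  suc n , λ v X → ⇔-sym (iter-suc⇔induct M Λ n g g⇔iter v X) ⇔-∘ f⇔induct v X

mainTheorem3 : {Π : Set} {m : ℕ} (M : Model Π) (w : W M) (Λ : Program Π m)
             → (M , w ⊨ᴾ Λ) ⇔ EloiseWins M w Λ
mainTheorem3 M w Λ = mk⇔ sound complete
  where
  sound : M , w ⊨ᴾ Λ → EloiseWins M w Λ
  sound (n , X , accepting , w⊨Xⁿ) =
    iterLabeling M Λ n , (X , accepting , w⊨Xⁿ) , EloiseWinsFrom-iterLabeling M Λ n

  complete : EloiseWins M w Λ → M , w ⊨ᴾ Λ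
  complete (f , (X , accepting , X∈fw) , wins) =
    let n , f⇔iter = EloiseWinsFrom⇒≈iterLabeling M Λ f wins
    in n , X , accepting , Equivalence.to (f⇔iter w X) X∈fw
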